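{- Let $\Gamma_1$ and $\Gamma_2$ be simple graphs on $n_1$ and $n_2$ vertices (with disjoint vertex sets) with adjacency matrices $A_1$ and $A_2$, and let $A$ be the adjacency matrix of the join $\Gamma_1\vee\Gamma_2$. If the binary codes generated by $[I_{n_1}|A_1]$ and $[I_{n_2}|A_2]$ are self-dual, then the binary code generated by $[I_{n_1+n_2}|A]$ is self-dual.
   Context: The join $\Gamma_1\vee\Gamma_2$ has vertex set $V_1\cup V_2$ and edge set consisting of all edges of $\Gamma_1$, all edges of $\Gamma_2$, and all edges between a vertex of $V_1$ and a vertex of $V_2$. The code generated by a matrix over $\mathbb{F}_2$ is its row space; a code $C$ is self-dual if $C=C^\perp$. -}

module Defs where

open import Data.Bool using (Bool; true; false; _xor_; _∧_)
open import Data.Nat using (ℕ; zero; suc; _+_)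
open import Data.Fin using (Fin; zero; suc; _↑ˡ_; _↑ʳ_; splitAt)
open import Data.Sum using (_⊎_; inj₁; inj₂)
open import Data.Product using (Σ; _×_; ∃)
open import Relation.Binary.PropositionalEquality using (_≡_)

-- The field F₂ is modelled by Bool: addition = xor, multiplication = ∧.

Vec₂ : ℕ → Set
Vec₂ n = Fin n → Bool

Mat₂ : ℕ → ℕ → Set
Mat₂ m n = Fin m → Fin n → Bool

sum₂ : ∀ {n} → (Fin n → Bool) → Bool
sum₂ {zero}  f = false
sum₂ {suc n} f = f zero xor sum₂ (λ i → f (suc i))

dot : ∀ {n} → Vec₂ n → Vec₂ n → Bool
dot x y = sum₂ (λ j → x j ∧ y j)

_≋_ : ∀ {n} → Vec₂ n → Vec₂ n → Set
x ≋ y = ∀ j → x j ≡ y j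

InCode : ∀ {m n} → Mat₂ m n → Vec₂ n → Set
InCode {m} M x = Σ (Vec₂ m) λ c → x ≋ (λ j → sum₂ (λ i → c i ∧ M i j))

InDual : ∀ {m n} → Mat₂ m n → Vec₂ n → Set
InDual M x = ∀ y → InCode M y → dot x y ≡ false

SelfDual : ∀ {m n} → Mat₂ m n → Set
SelfDual M = ∀ x → (InCode M x → InDual M x) × (InDual M x → InCode M x)

record SimpleGraph (n : ℕ) : Set where
  field
    adj   : Mat₂ n n
    sym   : ∀ i j → adj i j ≡ adj j i
    irrefl : ∀ i → adj i i ≡ false
open SimpleGraph public

-- adjacency matrix of the join Γ₁ ∨ Γ₂ on vertex set Fin n₁ ⊎ Fin n₂ ≅ Fin (n₁ + n₂)
-- (first n₁ indices = V₁, last n₂ indices = V₂)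
joinAdj : ∀ {n₁ n₂} → Mat₂ n₁ n₁ → Mat₂ n₂ n₂ → Mat₂ (n₁ + n₂) (n₁ + n₂)
joinAdj {n₁} A₁ A₂ i j with splitAt n₁ i | splitAt n₁ j
... | inj₁ a | inj₁ b = A₁ a b
... | inj₂ a | inj₂ b = A₂ a b
... | inj₁ _ | inj₂ _ = true
... | inj₂ _ | inj₁ _ = true

idMat : ∀ {n} → Mat₂ n n
idMat zero    zero    = true
idMat zero    (suc _) = false
idMat (suc _) zero    = false
idMat (suc i) (suc j) = idMat i j

IA : ∀ {n} → Mat₂ n n → Mat₂ n (n + n)
IA {n} A i j with splitAt n j
... | inj₁ k = idMat i k
... | inj₂ k = A i k

{-# OPTIONS --safe #-}
-- Over F₂, for a symmetric matrix A the code generated by [I | A] is self-dual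
-- exactly when A² = I: pairwise orthogonality of the rows says I + AAᵀ = 0, and
-- conversely a dual vector (u , v) is orthogonal to every row, which forces
-- u = vA and hence v = uA.  For an adjacency matrix, A² = I means every vertex
-- has odd degree, so by the handshake lemma the graph has an even number of
-- vertices.  The square of the join matrix [[A₁ , J] , [J , A₂]] then has diagonal
-- blocks A₁² + n₂J = I and A₂² + n₁J = I, and off-diagonal blocks A₁J + JA₂
-- whose entries are sums of two odd degrees, hence zero.
module Submission where

open import Algebra.Bundles using (CommutativeRing)
open import Data.Bool using (Bool; true; false; _xor_; _∧_)
open import Data.Bool.Properties
  using (∧-comm; ∧-assoc; ∧-idem; ∧-identityʳ; ∧-distribˡ-xor;
         xor-assoc; xor-identityʳ; xor-same; xor-∧-commutativeRing)
open import Algebra.Properties.CommutativeSemigroup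
  (CommutativeRing.+-commutativeSemigroup xor-∧-commutativeRing) using (interchange)
open import Data.Fin using (Fin; zero; suc; _↑ˡ_; _↑ʳ_; splitAt)
open import Data.Fin.Properties using (splitAt-↑ˡ; splitAt-↑ʳ; splitAt⁻¹-↑ˡ; splitAt⁻¹-↑ʳ)
open import Data.Nat using (ℕ; zero; suc; _+_)
open import Data.Product using (_,_; proj₁)
open import Data.Sum using (inj₁; inj₂)
open import Data.Vec.Functional using (take; drop)
open import Function using (_∘_)
open import Relation.Binary.PropositionalEquality
  using (_≡_; refl; sym; trans; cong; cong₂; subst; module ≡-Reasoning)

open import Defs hiding (sym)

open ≡-Reasoning

private variable
  l m n n₁ n₂ : ℕ

xor≡false⇒≡ : ∀ x y → x xor y ≡ false → x ≡ y
xor≡false⇒≡ false false _ = refl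
xor≡false⇒≡ true  true  _ = refl

-- Precedences above 20, the default fixity of _≋_, so that c ᵥ* M ≋ c′ ᵥ* M parses.
infix  24 _ᵀ
infixl 23 _⊗_
infixl 22 _ᵥ*_ _*ᵥ_
infix  4 _≋ₘ_

_ᵀ : Mat₂ m n → Mat₂ n m
(M ᵀ) i j = M j i

_⊗_ : Mat₂ l m → Mat₂ m n → Mat₂ l n
(M ⊗ N) i k = sum₂ (λ j → M i j ∧ N j k)

_ᵥ*_ : Vec₂ m → Mat₂ m n → Vec₂ n
(c ᵥ* M) j = sum₂ (λ i → c i ∧ M i j)

_*ᵥ_ : Mat₂ m n → Vec₂ n → Vec₂ m
(M *ᵥ y) i = dot (M i) y

_≋ₘ_ : Mat₂ m n → Mat₂ m n → Set
M ≋ₘ N = ∀ i j → M i j ≡ N i j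

IsSymmetric : Mat₂ n n → Set
IsSymmetric M = ∀ i j → M i j ≡ M j i

sum₂-cong : {f g : Fin n → Bool} → (∀ i → f i ≡ g i) → sum₂ f ≡ sum₂ g
sum₂-cong {zero}  f≗g = refl
sum₂-cong {suc n} f≗g = cong₂ _xor_ (f≗g zero) (sum₂-cong (f≗g ∘ suc))

sum₂-false : sum₂ {n} (λ _ → false) ≡ false
sum₂-false {zero}  = refl
sum₂-false {suc n} = sum₂-false {n}

sum₂-xor : (f g : Fin n → Bool) → sum₂ (λ i → f i xor g i) ≡ sum₂ f xor sum₂ g
sum₂-xor {zero}  f g = refl
sum₂-xor {suc n} f g =
  trans (cong ((f zero xor g zero) xor_) (sum₂-xor (f ∘ suc) (g ∘ suc)))
        (interchange (f zero) (g zero) _ _)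

∧-distribˡ-sum₂ : ∀ b (f : Fin n → Bool) → b ∧ sum₂ f ≡ sum₂ (λ i → b ∧ f i)
∧-distribˡ-sum₂ {zero}  false f = refl
∧-distribˡ-sum₂ {zero}  true  f = refl
∧-distribˡ-sum₂ {suc n} b f =
  trans (∧-distribˡ-xor b (f zero) _) (cong ((b ∧ f zero) xor_) (∧-distribˡ-sum₂ b (f ∘ suc)))

∧-distribʳ-sum₂ : ∀ b (f : Fin n → Bool) → sum₂ f ∧ b ≡ sum₂ (λ i → f i ∧ b)
∧-distribʳ-sum₂ b f =
  trans (∧-comm (sum₂ f) b) (trans (∧-distribˡ-sum₂ b f) (sum₂-cong λ i → ∧-comm b (f i)))

sum₂-swap : (f : Fin m → Fin n → Bool) →
            sum₂ (λ i → sum₂ (f i)) ≡ sum₂ (λ j → sum₂ (λ i → f i j))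
sum₂-swap {zero}  {n} f = sym (sum₂-false {n})
sum₂-swap {suc m}     f =
  trans (cong (sum₂ (f zero) xor_) (sum₂-swap (f ∘ suc)))
        (sym (sum₂-xor (f zero) (λ j → sum₂ (λ i → f (suc i) j))))

sum₂-++ : ∀ m (f : Fin (m + n) → Bool) → sum₂ f ≡ sum₂ (take m f) xor sum₂ (drop m f)
sum₂-++ zero    f = refl
sum₂-++ (suc m) f = trans (cong (f zero xor_) (sum₂-++ m (f ∘ suc))) (sym (xor-assoc (f zero) _ _))

sum₂-idMat : (i : Fin n) (f : Fin n → Bool) → sum₂ (λ j → idMat i j ∧ f j) ≡ f i
sum₂-idMat {suc n} zero    f = trans (cong (f zero xor_) (sum₂-false {n})) (xor-identityʳ (f zero))
sum₂-idMat {suc n} (suc i) f = sum₂-idMat i (f ∘ suc)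

idMat-sym : IsSymmetric (idMat {n})
idMat-sym zero    zero    = refl
idMat-sym zero    (suc j) = refl
idMat-sym (suc i) zero    = refl
idMat-sym (suc i) (suc j) = idMat-sym i j

idMat-diagonal : (i : Fin n) → idMat i i ≡ true
idMat-diagonal zero    = refl
idMat-diagonal (suc i) = idMat-diagonal i

dot-cong : {x x′ y y′ : Vec₂ n} → x ≋ x′ → y ≋ y′ → dot x y ≡ dot x′ y′
dot-cong x≋x′ y≋y′ = sum₂-cong λ j → cong₂ _∧_ (x≋x′ j) (y≋y′ j)

dot-comm : (x y : Vec₂ n) → dot x y ≡ dot y x
dot-comm x y = sum₂-cong λ j → ∧-comm (x j) (y j)

dot-idMat : (x : Vec₂ n) (i : Fin n) → dot x (idMat i) ≡ x i
dot-idMat x i = trans (dot-comm x (idMat i)) (sum₂-idMat i x)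

dot-++ : ∀ m (x y : Vec₂ (m + n)) →
         dot x y ≡ dot (take m x) (take m y) xor dot (drop m x) (drop m y)
dot-++ m x y = sum₂-++ m (λ j → x j ∧ y j)

dot-*ᵥ : (x : Vec₂ m) (M : Mat₂ m n) (y : Vec₂ n) → dot x (M *ᵥ y) ≡ dot (x ᵥ* M) y
dot-*ᵥ x M y = begin
  sum₂ (λ i → x i ∧ sum₂ (λ j → M i j ∧ y j))   ≡⟨ sum₂-cong (λ i → ∧-distribˡ-sum₂ (x i) (λ j → M i j ∧ y j)) ⟩
  sum₂ (λ i → sum₂ (λ j → x i ∧ (M i j ∧ y j))) ≡⟨ sum₂-swap (λ i j → x i ∧ (M i j ∧ y j)) ⟩
  sum₂ (λ j → sum₂ (λ i → x i ∧ (M i j ∧ y j))) ≡⟨ sum₂-cong (λ j → sum₂-cong λ i → sym (∧-assoc (x i) (M i j) (y j))) ⟩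
  sum₂ (λ j → sum₂ (λ i → (x i ∧ M i j) ∧ y j)) ≡⟨ sum₂-cong (λ j → sym (∧-distribʳ-sum₂ (y j) (λ i → x i ∧ M i j))) ⟩
  sum₂ (λ j → (x ᵥ* M) j ∧ y j)                 ∎

ᵥ*-cong : {c c′ : Vec₂ m} (M : Mat₂ m n) → c ≋ c′ → c ᵥ* M ≋ c′ ᵥ* M
ᵥ*-cong M c≋c′ j = sum₂-cong λ i → cong (_∧ M i j) (c≋c′ i)

ᵥ*-⊗ : (c : Vec₂ l) (M : Mat₂ l m) (N : Mat₂ m n) → c ᵥ* M ᵥ* N ≋ c ᵥ* (M ⊗ N)
ᵥ*-⊗ c M N k = sym (dot-*ᵥ c M (λ j → N j k))

ᵥ*-idMat : (c : Vec₂ n) → c ᵥ* idMat ≋ c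
ᵥ*-idMat c j = trans (sum₂-cong λ i → cong (c i ∧_) (idMat-sym i j)) (dot-idMat c j)

idMat-ᵥ* : (i : Fin m) (M : Mat₂ m n) → idMat i ᵥ* M ≋ M i
idMat-ᵥ* i M j = sum₂-idMat i (λ k → M k j)

*ᵥ-symmetric : {M : Mat₂ n n} → IsSymmetric M → (y : Vec₂ n) → M *ᵥ y ≋ y ᵥ* M
*ᵥ-symmetric {M = M} M-sym y i = sum₂-cong λ j → trans (∧-comm (M i j) (y j)) (cong (y j ∧_) (M-sym i j))

splitAt-elim : ∀ m {n} (P : Fin (m + n) → Set) →
               (∀ a → P (a ↑ˡ n)) → (∀ b → P (m ↑ʳ b)) → ∀ i → P i
splitAt-elim m {n} P left right i with splitAt m {n} i in eq
... | inj₁ a = subst P (splitAt⁻¹-↑ˡ eq) (left a)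
... | inj₂ b = subst P (splitAt⁻¹-↑ʳ eq) (right b)

≋-take-drop : ∀ m {x y : Vec₂ (m + n)} → take m x ≋ take m y → drop m x ≋ drop m y → x ≋ y
≋-take-drop m {x} {y} = splitAt-elim m (λ j → x j ≡ y j)

codeword : (M : Mat₂ m n) (c : Vec₂ m) → InCode M (c ᵥ* M)
codeword M c = c , λ _ → refl

module _ (A : Mat₂ n n) where

  IA-↑ˡ : ∀ i a → IA A i (a ↑ˡ n) ≡ idMat i a
  IA-↑ˡ i a rewrite splitAt-↑ˡ n a n = refl

  IA-↑ʳ : ∀ i b → IA A i (n ↑ʳ b) ≡ A i b
  IA-↑ʳ i b rewrite splitAt-↑ʳ n n b = refl

  take-ᵥ*IA : (c : Vec₂ n) → take n (c ᵥ* IA A) ≋ c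
  take-ᵥ*IA c a = trans (sum₂-cong λ i → cong (c i ∧_) (IA-↑ˡ i a)) (ᵥ*-idMat c a)

  drop-ᵥ*IA : (c : Vec₂ n) → drop n (c ᵥ* IA A) ≋ c ᵥ* A
  drop-ᵥ*IA c b = sum₂-cong λ i → cong (c i ∧_) (IA-↑ʳ i b)

  dot-ᵥ*IA : (x : Vec₂ (n + n)) (c : Vec₂ n) →
             dot x (c ᵥ* IA A) ≡ dot (take n x) c xor dot (drop n x) (c ᵥ* A)
  dot-ᵥ*IA x c = trans (dot-++ n x (c ᵥ* IA A))
    (cong₂ _xor_ (dot-cong (λ _ → refl) (take-ᵥ*IA c)) (dot-cong (λ _ → refl) (drop-ᵥ*IA c)))

  dot-ᵥ*IA-ᵥ*IA : (c d : Vec₂ n) →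
                  dot (c ᵥ* IA A) (d ᵥ* IA A) ≡ dot c d xor dot (c ᵥ* A) (d ᵥ* A)
  dot-ᵥ*IA-ᵥ*IA c d = trans (dot-ᵥ*IA (c ᵥ* IA A) d)
    (cong₂ _xor_ (dot-cong (take-ᵥ*IA c) (λ _ → refl)) (dot-cong (drop-ᵥ*IA c) (λ _ → refl)))

  selfDual-IA⇒⊗ᵀ≋idMat : SelfDual (IA A) → A ⊗ A ᵀ ≋ₘ idMat
  selfDual-IA⇒⊗ᵀ≋idMat selfDual i k = sym (xor≡false⇒≡ (idMat i k) _ rowsOrthogonal)
    where
    rowsOrthogonal : idMat i k xor (A ⊗ A ᵀ) i k ≡ false
    rowsOrthogonal = begin
      idMat i k xor (A ⊗ A ᵀ) i k
        ≡⟨ sym (cong₂ _xor_ (dot-idMat (idMat i) k) (dot-cong (idMat-ᵥ* i A) (idMat-ᵥ* k A))) ⟩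
      dot (idMat i) (idMat k) xor dot (idMat i ᵥ* A) (idMat k ᵥ* A)
        ≡⟨ sym (dot-ᵥ*IA-ᵥ*IA (idMat i) (idMat k)) ⟩
      dot (idMat i ᵥ* IA A) (idMat k ᵥ* IA A)
        ≡⟨ proj₁ (selfDual _) (codeword (IA A) (idMat i)) _ (codeword (IA A) (idMat k)) ⟩
      false ∎

  ᵥ*-involutive : A ⊗ A ≋ₘ idMat → (c : Vec₂ n) → c ᵥ* A ᵥ* A ≋ c
  ᵥ*-involutive A²≋I c k = trans (ᵥ*-⊗ c A A k)
    (trans (sum₂-cong λ i → cong (c i ∧_) (A²≋I i k)) (ᵥ*-idMat c k))

  dot-ᵥ*-orthogonal : IsSymmetric A → A ⊗ A ≋ₘ idMat →
                      (c d : Vec₂ n) → dot (c ᵥ* A) (d ᵥ* A) ≡ dot c d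
  dot-ᵥ*-orthogonal A-sym A²≋I c d = begin
    dot (c ᵥ* A) (d ᵥ* A)     ≡⟨ dot-cong (λ _ → refl) (λ k → sym (*ᵥ-symmetric A-sym d k)) ⟩
    dot (c ᵥ* A) (A *ᵥ d)     ≡⟨ dot-*ᵥ (c ᵥ* A) A d ⟩
    dot (c ᵥ* A ᵥ* A) d       ≡⟨ dot-cong (ᵥ*-involutive A²≋I c) (λ _ → refl) ⟩
    dot c d                   ∎

  ⊗≋idMat⇒selfDual-IA : IsSymmetric A → A ⊗ A ≋ₘ idMat → SelfDual (IA A)
  ⊗≋idMat⇒selfDual-IA A-sym A²≋I x = code⊆dual , dual⊆code
    where
    code⊆dual : InCode (IA A) x → InDual (IA A) x
    code⊆dual (c , x≋c) y (d , y≋d) = begin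
      dot x y                                 ≡⟨ dot-cong x≋c y≋d ⟩
      dot (c ᵥ* IA A) (d ᵥ* IA A)             ≡⟨ dot-ᵥ*IA-ᵥ*IA c d ⟩
      dot c d xor dot (c ᵥ* A) (d ᵥ* A)       ≡⟨ cong (dot c d xor_) (dot-ᵥ*-orthogonal A-sym A²≋I c d) ⟩
      dot c d xor dot c d                     ≡⟨ xor-same (dot c d) ⟩
      false                                   ∎

    dual⊆code : InDual (IA A) x → InCode (IA A) x
    dual⊆code x⊥ = u , ≋-take-drop n (λ a → sym (take-ᵥ*IA u a)) v≋uA
      where
      u v : Vec₂ n
      u = take n x
      v = drop n x

      u≋vA : u ≋ v ᵥ* A
      u≋vA i = xor≡false⇒≡ (u i) ((v ᵥ* A) i) (begin
        u i xor (v ᵥ* A) i                    ≡⟨ sym (cong₂ _xor_ (dot-idMat u i) (*ᵥ-symmetric A-sym v i)) ⟩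
        dot u (idMat i) xor (A *ᵥ v) i        ≡⟨ cong (dot u (idMat i) xor_) (dot-comm (A i) v) ⟩
        dot u (idMat i) xor dot v (A i)       ≡⟨ sym (cong (dot u (idMat i) xor_) (dot-cong (λ _ → refl) (idMat-ᵥ* i A))) ⟩
        dot u (idMat i) xor dot v (idMat i ᵥ* A) ≡⟨ sym (dot-ᵥ*IA x (idMat i)) ⟩
        dot x (idMat i ᵥ* IA A)               ≡⟨ x⊥ _ (codeword (IA A) (idMat i)) ⟩
        false                                 ∎)

      v≋uA : drop n x ≋ drop n (u ᵥ* IA A)
      v≋uA b = begin
        v b                 ≡⟨ sym (ᵥ*-involutive A²≋I v b) ⟩
        (v ᵥ* A ᵥ* A) b     ≡⟨ ᵥ*-cong A (λ i → sym (u≋vA i)) b ⟩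
        (u ᵥ* A) b          ≡⟨ sym (drop-ᵥ*IA u b) ⟩
        drop n (u ᵥ* IA A) b ∎

selfDual-IA⇒adj²≋idMat : (Γ : SimpleGraph n) → SelfDual (IA (adj Γ)) → adj Γ ⊗ adj Γ ≋ₘ idMat
selfDual-IA⇒adj²≋idMat Γ selfDual i k =
  trans (sum₂-cong λ j → cong (adj Γ i j ∧_) (SimpleGraph.sym Γ j k))
        (selfDual-IA⇒⊗ᵀ≋idMat (adj Γ) selfDual i k)

degree-odd : {M : Mat₂ n n} → IsSymmetric M → M ⊗ M ≋ₘ idMat → ∀ i → sum₂ (M i) ≡ true
degree-odd {M = M} M-sym M²≋I i = begin
  sum₂ (M i)                    ≡⟨ sum₂-cong (λ j → sym (∧-idem (M i j))) ⟩
  sum₂ (λ j → M i j ∧ M i j)    ≡⟨ sum₂-cong (λ j → cong (M i j ∧_) (M-sym i j)) ⟩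
  (M ⊗ M) i i                   ≡⟨ M²≋I i i ⟩
  idMat i i                     ≡⟨ idMat-diagonal i ⟩
  true                          ∎

handshake : {M : Mat₂ n n} → IsSymmetric M → (∀ i → M i i ≡ false) →
            sum₂ (λ i → sum₂ (M i)) ≡ false
handshake {zero}          M-sym M-irrefl = refl
handshake {suc n} {M = M} M-sym M-irrefl = begin
  (M zero zero xor firstRow) xor sum₂ (λ i → M (suc i) zero xor sum₂ (M′ i))
    ≡⟨ cong₂ _xor_ (cong (_xor firstRow) (M-irrefl zero)) (sum₂-xor (λ i → M (suc i) zero) (sum₂ ∘ M′)) ⟩
  firstRow xor (sum₂ (λ i → M (suc i) zero) xor sum₂ (sum₂ ∘ M′))
    ≡⟨ cong (firstRow xor_) (cong₂ _xor_ (sum₂-cong λ i → M-sym (suc i) zero)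
                                          (handshake (λ i j → M-sym (suc i) (suc j)) (M-irrefl ∘ suc))) ⟩
  firstRow xor (firstRow xor false)
    ≡⟨ cong (firstRow xor_) (xor-identityʳ firstRow) ⟩
  firstRow xor firstRow
    ≡⟨ xor-same firstRow ⟩
  false ∎
  where
  M′ : Mat₂ n n
  M′ i j = M (suc i) (suc j)

  firstRow : Bool
  firstRow = sum₂ (λ j → M zero (suc j))

order-even : (Γ : SimpleGraph n) → adj Γ ⊗ adj Γ ≋ₘ idMat → sum₂ {n} (λ _ → true) ≡ false
order-even Γ A²≋I = trans (sum₂-cong λ i → sym (degree-odd (SimpleGraph.sym Γ) A²≋I i))
                          (handshake (SimpleGraph.sym Γ) (SimpleGraph.irrefl Γ))

splitAt-elim₂ : ∀ m {n} (P : Fin (m + n) → Fin (m + n) → Set) →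
                (∀ a a′ → P (a ↑ˡ n) (a′ ↑ˡ n)) → (∀ a b → P (a ↑ˡ n) (m ↑ʳ b)) →
                (∀ b a → P (m ↑ʳ b) (a ↑ˡ n)) → (∀ b b′ → P (m ↑ʳ b) (m ↑ʳ b′)) →
                ∀ i j → P i j
splitAt-elim₂ m {n} P ll lr rl rr = splitAt-elim m (λ i → ∀ j → P i j)
  (λ a → splitAt-elim m (P (a ↑ˡ n)) (ll a) (lr a))
  (λ b → splitAt-elim m (P (m ↑ʳ b)) (rl b) (rr b))

idMat-↑ˡ-↑ˡ : ∀ n (a a′ : Fin m) → idMat (a ↑ˡ n) (a′ ↑ˡ n) ≡ idMat a a′
idMat-↑ˡ-↑ˡ n zero    zero     = refl
idMat-↑ˡ-↑ˡ n zero    (suc a′) = refl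
idMat-↑ˡ-↑ˡ n (suc a) zero     = refl
idMat-↑ˡ-↑ˡ n (suc a) (suc a′) = idMat-↑ˡ-↑ˡ n a a′

idMat-↑ˡ-↑ʳ : ∀ n (a : Fin m) (b : Fin n) → idMat (a ↑ˡ n) (m ↑ʳ b) ≡ false
idMat-↑ˡ-↑ʳ n zero    b = refl
idMat-↑ˡ-↑ʳ n (suc a) b = idMat-↑ˡ-↑ʳ n a b

idMat-↑ʳ-↑ˡ : ∀ n (a : Fin m) (b : Fin n) → idMat (m ↑ʳ b) (a ↑ˡ n) ≡ false
idMat-↑ʳ-↑ˡ {m} n a b = trans (idMat-sym (m ↑ʳ b) (a ↑ˡ n)) (idMat-↑ˡ-↑ʳ n a b)

idMat-↑ʳ-↑ʳ : ∀ m (b b′ : Fin n) → idMat (m ↑ʳ b) (m ↑ʳ b′) ≡ idMat b b′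
idMat-↑ʳ-↑ʳ zero    b b′ = refl
idMat-↑ʳ-↑ʳ (suc m) b b′ = idMat-↑ʳ-↑ʳ m b b′

module _ (A₁ : Mat₂ n₁ n₁) (A₂ : Mat₂ n₂ n₂) where

  joinAdj-↑ˡ-↑ˡ : ∀ a a′ → joinAdj A₁ A₂ (a ↑ˡ n₂) (a′ ↑ˡ n₂) ≡ A₁ a a′
  joinAdj-↑ˡ-↑ˡ a a′ rewrite splitAt-↑ˡ n₁ a n₂ | splitAt-↑ˡ n₁ a′ n₂ = refl

  joinAdj-↑ˡ-↑ʳ : ∀ a b → joinAdj A₁ A₂ (a ↑ˡ n₂) (n₁ ↑ʳ b) ≡ true
  joinAdj-↑ˡ-↑ʳ a b rewrite splitAt-↑ˡ n₁ a n₂ | splitAt-↑ʳ n₁ n₂ b = refl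

  joinAdj-↑ʳ-↑ˡ : ∀ b a → joinAdj A₁ A₂ (n₁ ↑ʳ b) (a ↑ˡ n₂) ≡ true
  joinAdj-↑ʳ-↑ˡ b a rewrite splitAt-↑ˡ n₁ a n₂ | splitAt-↑ʳ n₁ n₂ b = refl

  joinAdj-↑ʳ-↑ʳ : ∀ b b′ → joinAdj A₁ A₂ (n₁ ↑ʳ b) (n₁ ↑ʳ b′) ≡ A₂ b b′
  joinAdj-↑ʳ-↑ʳ b b′ rewrite splitAt-↑ʳ n₁ n₂ b | splitAt-↑ʳ n₁ n₂ b′ = refl

  joinAdj-symmetric : IsSymmetric A₁ → IsSymmetric A₂ → IsSymmetric (joinAdj A₁ A₂)
  joinAdj-symmetric A₁-sym A₂-sym = splitAt-elim₂ n₁ (λ i j → J i j ≡ J j i)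
    (λ a a′ → trans (joinAdj-↑ˡ-↑ˡ a a′) (trans (A₁-sym a a′) (sym (joinAdj-↑ˡ-↑ˡ a′ a))))
    (λ a b → trans (joinAdj-↑ˡ-↑ʳ a b) (sym (joinAdj-↑ʳ-↑ˡ b a)))
    (λ b a → trans (joinAdj-↑ʳ-↑ˡ b a) (sym (joinAdj-↑ˡ-↑ʳ a b)))
    (λ b b′ → trans (joinAdj-↑ʳ-↑ʳ b b′) (trans (A₂-sym b b′) (sym (joinAdj-↑ʳ-↑ʳ b′ b))))
    where
    J : Mat₂ (n₁ + n₂) (n₁ + n₂)
    J = joinAdj A₁ A₂

  joinAdj²-blocks : ∀ i k {f : Fin n₁ → Bool} {g : Fin n₂ → Bool} →
                    (∀ c → joinAdj A₁ A₂ i (c ↑ˡ n₂) ∧ joinAdj A₁ A₂ (c ↑ˡ n₂) k ≡ f c) →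
                    (∀ d → joinAdj A₁ A₂ i (n₁ ↑ʳ d) ∧ joinAdj A₁ A₂ (n₁ ↑ʳ d) k ≡ g d) →
                    (joinAdj A₁ A₂ ⊗ joinAdj A₁ A₂) i k ≡ sum₂ f xor sum₂ g
  joinAdj²-blocks i k left right = trans (sum₂-++ n₁ _) (cong₂ _xor_ (sum₂-cong left) (sum₂-cong right))

module _ (Γ₁ : SimpleGraph n₁) (Γ₂ : SimpleGraph n₂)
         (A₁²≋I : adj Γ₁ ⊗ adj Γ₁ ≋ₘ idMat) (A₂²≋I : adj Γ₂ ⊗ adj Γ₂ ≋ₘ idMat) where

  private
    A₁ = adj Γ₁
    A₂ = adj Γ₂
    J  = joinAdj A₁ A₂

    columnSum₁ : ∀ a → sum₂ (λ c → A₁ c a) ≡ true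
    columnSum₁ a = trans (sum₂-cong λ c → SimpleGraph.sym Γ₁ c a) (degree-odd (SimpleGraph.sym Γ₁) A₁²≋I a)

    columnSum₂ : ∀ b → sum₂ (λ d → A₂ d b) ≡ true
    columnSum₂ b = trans (sum₂-cong λ d → SimpleGraph.sym Γ₂ d b) (degree-odd (SimpleGraph.sym Γ₂) A₂²≋I b)

  joinAdj²-↑ˡ-↑ˡ : ∀ a a′ → (J ⊗ J) (a ↑ˡ n₂) (a′ ↑ˡ n₂) ≡ idMat (a ↑ˡ n₂) (a′ ↑ˡ n₂)
  joinAdj²-↑ˡ-↑ˡ a a′ = begin
    (J ⊗ J) (a ↑ˡ n₂) (a′ ↑ˡ n₂)
      ≡⟨ joinAdj²-blocks A₁ A₂ _ _ (λ c → cong₂ _∧_ (joinAdj-↑ˡ-↑ˡ A₁ A₂ a c) (joinAdj-↑ˡ-↑ˡ A₁ A₂ c a′))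
                                   (λ d → cong₂ _∧_ (joinAdj-↑ˡ-↑ʳ A₁ A₂ a d) (joinAdj-↑ʳ-↑ˡ A₁ A₂ d a′)) ⟩
    (A₁ ⊗ A₁) a a′ xor sum₂ {n₂} (λ _ → true) ≡⟨ cong₂ _xor_ (A₁²≋I a a′) (order-even Γ₂ A₂²≋I) ⟩
    idMat a a′ xor false                       ≡⟨ xor-identityʳ (idMat a a′) ⟩
    idMat a a′                                 ≡⟨ sym (idMat-↑ˡ-↑ˡ n₂ a a′) ⟩
    idMat (a ↑ˡ n₂) (a′ ↑ˡ n₂)                 ∎

  joinAdj²-↑ˡ-↑ʳ : ∀ a b → (J ⊗ J) (a ↑ˡ n₂) (n₁ ↑ʳ b) ≡ idMat (a ↑ˡ n₂) (n₁ ↑ʳ b)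
  joinAdj²-↑ˡ-↑ʳ a b = begin
    (J ⊗ J) (a ↑ˡ n₂) (n₁ ↑ʳ b)
      ≡⟨ joinAdj²-blocks A₁ A₂ _ _
           (λ c → trans (cong₂ _∧_ (joinAdj-↑ˡ-↑ˡ A₁ A₂ a c) (joinAdj-↑ˡ-↑ʳ A₁ A₂ c b)) (∧-identityʳ (A₁ a c)))
           (λ d → cong₂ _∧_ (joinAdj-↑ˡ-↑ʳ A₁ A₂ a d) (joinAdj-↑ʳ-↑ʳ A₁ A₂ d b)) ⟩
    sum₂ (A₁ a) xor sum₂ (λ d → A₂ d b) ≡⟨ cong₂ _xor_ (degree-odd (SimpleGraph.sym Γ₁) A₁²≋I a) (columnSum₂ b) ⟩
    false                               ≡⟨ sym (idMat-↑ˡ-↑ʳ n₂ a b) ⟩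
    idMat (a ↑ˡ n₂) (n₁ ↑ʳ b)           ∎

  joinAdj²-↑ʳ-↑ˡ : ∀ b a → (J ⊗ J) (n₁ ↑ʳ b) (a ↑ˡ n₂) ≡ idMat (n₁ ↑ʳ b) (a ↑ˡ n₂)
  joinAdj²-↑ʳ-↑ˡ b a = begin
    (J ⊗ J) (n₁ ↑ʳ b) (a ↑ˡ n₂)
      ≡⟨ joinAdj²-blocks A₁ A₂ _ _
           (λ c → cong₂ _∧_ (joinAdj-↑ʳ-↑ˡ A₁ A₂ b c) (joinAdj-↑ˡ-↑ˡ A₁ A₂ c a))
           (λ d → trans (cong₂ _∧_ (joinAdj-↑ʳ-↑ʳ A₁ A₂ b d) (joinAdj-↑ʳ-↑ˡ A₁ A₂ d a)) (∧-identityʳ (A₂ b d))) ⟩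
    sum₂ (λ c → A₁ c a) xor sum₂ (A₂ b) ≡⟨ cong₂ _xor_ (columnSum₁ a) (degree-odd (SimpleGraph.sym Γ₂) A₂²≋I b) ⟩
    false                               ≡⟨ sym (idMat-↑ʳ-↑ˡ n₂ a b) ⟩
    idMat (n₁ ↑ʳ b) (a ↑ˡ n₂)           ∎

  joinAdj²-↑ʳ-↑ʳ : ∀ b b′ → (J ⊗ J) (n₁ ↑ʳ b) (n₁ ↑ʳ b′) ≡ idMat (n₁ ↑ʳ b) (n₁ ↑ʳ b′)
  joinAdj²-↑ʳ-↑ʳ b b′ = begin
    (J ⊗ J) (n₁ ↑ʳ b) (n₁ ↑ʳ b′)
      ≡⟨ joinAdj²-blocks A₁ A₂ _ _
           (λ c → cong₂ _∧_ (joinAdj-↑ʳ-↑ˡ A₁ A₂ b c) (joinAdj-↑ˡ-↑ʳ A₁ A₂ c b′))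
           (λ d → cong₂ _∧_ (joinAdj-↑ʳ-↑ʳ A₁ A₂ b d) (joinAdj-↑ʳ-↑ʳ A₁ A₂ d b′)) ⟩
    sum₂ {n₁} (λ _ → true) xor (A₂ ⊗ A₂) b b′ ≡⟨ cong₂ _xor_ (order-even Γ₁ A₁²≋I) (A₂²≋I b b′) ⟩
    idMat b b′                                 ≡⟨ sym (idMat-↑ʳ-↑ʳ n₁ b b′) ⟩
    idMat (n₁ ↑ʳ b) (n₁ ↑ʳ b′)                 ∎

  joinAdj²≋idMat : J ⊗ J ≋ₘ idMat
  joinAdj²≋idMat = splitAt-elim₂ n₁ (λ i k → (J ⊗ J) i k ≡ idMat i k)
    joinAdj²-↑ˡ-↑ˡ joinAdj²-↑ˡ-↑ʳ joinAdj²-↑ʳ-↑ˡ joinAdj²-↑ʳ-↑ʳ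

mainTheorem15 : (n₁ n₂ : ℕ) (Γ₁ : SimpleGraph n₁) (Γ₂ : SimpleGraph n₂) →
    SelfDual (IA (adj Γ₁)) → SelfDual (IA (adj Γ₂)) →
    SelfDual (IA (joinAdj (adj Γ₁) (adj Γ₂)))
mainTheorem15 n₁ n₂ Γ₁ Γ₂ selfDual₁ selfDual₂ =
  ⊗≋idMat⇒selfDual-IA (joinAdj (adj Γ₁) (adj Γ₂))
    (joinAdj-symmetric (adj Γ₁) (adj Γ₂) (SimpleGraph.sym Γ₁) (SimpleGraph.sym Γ₂))
    (joinAdj²≋idMat Γ₁ Γ₂ (selfDual-IA⇒adj²≋idMat Γ₁ selfDual₁) (selfDual-IA⇒adj²≋idMat Γ₂ selfDual₂))
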